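{- Let $Q=(q_k)_{k\ge1}$ be a sequence of integers with $q_k>1$, let $q=\min_n q_n$, and fix $\varepsilon\in\{0,1,\dots,q-1\}$. Let $\varepsilon_k\in\{0,1,\dots,q_k-1\}$ for all $k$ and $x=\sum_{k=1}^\infty\frac{\varepsilon_k}{q_1q_2\cdots q_k}$, and for $n\ge0$ put $\sigma^n(x)=\sum_{k=n+1}^\infty\frac{\varepsilon_k}{q_{n+1}\cdots q_k}$. Then [$\sigma^n(x)=x=\frac{\varepsilon}{q-1}$ for all positive integers $n$] holds if and only if $\varepsilon_n=\frac{q_n-1}{q-1}\varepsilon$ (in particular this quantity is a nonnegative integer) for all positive integers $n$. -}

module Defs where

open import Data.Nat using (ℕ; zero; suc; _*_; _≤_)
open import Data.Integer using (+_)
open import Data.Rational using (ℚ; 0ℚ; _+_; _-_; ∣_∣; _<_; Positive; _/_)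
open import Data.Product using (∃-syntax)

-- Sequences are 0-indexed: q i stands for the paper's q_{i+1}, e i for ε_{i+1}.

-- a / b as a rational; the case b = 0 never arises under the hypotheses
-- (all denominators used are ≥ 1) and is set to 0 only to make the function total.
divℕ : ℕ → ℕ → ℚ
divℕ a zero = 0ℚ
divℕ a (suc b) = (+ a) / suc b

prod : (ℕ → ℕ) → ℕ → ℕ → ℕ
prod q n zero = 1
prod q n (suc l) = q n * prod q (suc n) l

-- partial sums of σ^n(x):  Σ_{j<m} e (n+j) / (q n ⋯ q (n+j))
-- (paper: Σ_{k=n+1}^{n+m} ε_k / (q_{n+1} ⋯ q_k))
tailPartial : (ℕ → ℕ) → (ℕ → ℕ) → ℕ → ℕ → ℚ
tailPartial q e n zero = 0ℚ
tailPartial q e n (suc m) = tailPartial q e n m + divℕ (e (n Data.Nat.+ m)) (prod q n (suc m))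

-- a rational sequence converges (in ℚ, equivalently in ℝ) to the rational L
ConvergesTo : (ℕ → ℚ) → ℚ → Set
ConvergesTo s L = ∀ (δ : ℚ) → Positive δ → ∃[ N ] (∀ m → N ≤ m → ∣ s m - L ∣ < δ)

-- Write T n m for the m-th partial sum of σⁿ(x) and c = ε / (q - 1). Splitting off the
-- first term gives q_n · T n (m+1) = e_n + T (n+1) m. If every T n tends to c, passing to
-- the limit yields e_n + c = q_n c, which is e_n (q - 1) = (q_n - 1) ε. Conversely, if
-- e_n + c = q_n c for all n, the same identity shows by induction on m that
-- (q_n ⋯ q_{n+m-1}) (T n m - c) = - c, so |T n m - c| ≤ |c| / (m + 1) tends to 0.
module Submission where

open import Defs
open import Data.Nat as ℕ using (ℕ; zero; suc; z≤n; s≤s; NonZero)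
import Data.Nat.Properties as ℕₚ
open import Data.Nat.Coprimality using (Coprime)
open import Data.Integer as ℤ using (+_; +[1+_]; -[1+_])
import Data.Integer.Properties as ℤₚ
open import Data.Rational as ℚ
  using (ℚ; mkℚ; 0ℚ; 1ℚ; toℚᵘ; _+_; _*_; _-_; -_; ∣_∣; _<_; _≤_; Positive; NonNegative; 1/_)
import Data.Rational.Properties as ℚₚ
open import Data.Rational.Solver using (module +-*-Solver)
import Data.Rational.Unnormalised as ℚᵘ
import Data.Rational.Unnormalised.Properties as ℚᵘₚ
open import Relation.Binary.PropositionalEquality
open import Relation.Binary.Definitions using (tri<; tri≈; tri>)
open import Data.Product using (∃-syntax; _,_; proj₁; proj₂)
open import Data.Empty using (⊥-elim)
open import Function using (_∘_; _⇔_; mk⇔; Equivalence)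

open +-*-Solver using (solve; _:=_; _:+_; _:*_; _:-_; :-_; con)

fromℕ : ℕ → ℚ
fromℕ n = + n ℚ./ 1

toℚᵘ-divℕ : ∀ a b → toℚᵘ (divℕ a (suc b)) ℚᵘ.≃ ℚᵘ.mkℚᵘ (+ a) b
toℚᵘ-divℕ a b = ℚₚ.toℚᵘ-fromℚᵘ (ℚᵘ.mkℚᵘ (+ a) b)

≡-via-toℚᵘ : ∀ {p r} (u : ℚᵘ.ℚᵘ) → toℚᵘ p ℚᵘ.≃ u → toℚᵘ r ℚᵘ.≃ u → p ≡ r
≡-via-toℚᵘ u p≃u r≃u = ℚₚ.toℚᵘ-injective (ℚᵘₚ.≃-trans p≃u (ℚᵘₚ.≃-sym r≃u))

fromℕ-+ : ∀ a b → fromℕ (a ℕ.+ b) ≡ fromℕ a + fromℕ b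
fromℕ-+ a b = ≡-via-toℚᵘ (ℚᵘ.mkℚᵘ (+ a) 0 ℚᵘ.+ ℚᵘ.mkℚᵘ (+ b) 0)
  (ℚᵘₚ.≃-trans (toℚᵘ-divℕ (a ℕ.+ b) 0) (ℚᵘ.*≡* (begin
    + (a ℕ.+ b) ℤ.* + 1         ≡⟨ ℤₚ.*-identityʳ _ ⟩
    + (a ℕ.+ b)                 ≡⟨ ℤₚ.pos-+ a b ⟩
    + a ℤ.+ + b                 ≡⟨ cong₂ ℤ._+_ (ℤₚ.*-identityʳ (+ a)) (ℤₚ.*-identityʳ (+ b)) ⟨
    + a ℤ.* + 1 ℤ.+ + b ℤ.* + 1 ≡⟨ ℤₚ.*-identityʳ _ ⟨
    (+ a ℤ.* + 1 ℤ.+ + b ℤ.* + 1) ℤ.* + 1 ∎)))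
  (ℚᵘₚ.≃-trans (ℚₚ.toℚᵘ-homo-+ (fromℕ a) (fromℕ b)) (ℚᵘₚ.+-cong (toℚᵘ-divℕ a 0) (toℚᵘ-divℕ b 0)))
  where open ≡-Reasoning

fromℕ-* : ∀ a b → fromℕ (a ℕ.* b) ≡ fromℕ a * fromℕ b
fromℕ-* a b = ≡-via-toℚᵘ (ℚᵘ.mkℚᵘ (+ a) 0 ℚᵘ.* ℚᵘ.mkℚᵘ (+ b) 0)
  (ℚᵘₚ.≃-trans (toℚᵘ-divℕ (a ℕ.* b) 0) (ℚᵘ.*≡* (cong (ℤ._* + 1) (ℤₚ.pos-* a b))))
  (ℚᵘₚ.≃-trans (ℚₚ.toℚᵘ-homo-* (fromℕ a) (fromℕ b)) (ℚᵘₚ.*-cong (toℚᵘ-divℕ a 0) (toℚᵘ-divℕ b 0)))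

fromℕ-injective : ∀ {a b} → fromℕ a ≡ fromℕ b → a ≡ b
fromℕ-injective {a} {b} eq with ℚᵘₚ.≃-trans (ℚᵘₚ.≃-sym (toℚᵘ-divℕ a 0)) (ℚᵘₚ.≃-trans (ℚₚ.toℚᵘ-cong eq) (toℚᵘ-divℕ b 0))
... | ℚᵘ.*≡* a*1≡b*1 = ℤₚ.+-injective (ℤₚ.*-cancelʳ-≡ (+ a) (+ b) (+ 1) a*1≡b*1)

fromℕ-mono-≤ : ∀ {a b} → a ℕ.≤ b → fromℕ a ≤ fromℕ b
fromℕ-mono-≤ {a} {b} a≤b = ℚₚ.toℚᵘ-cancel-≤ (ℚᵘₚ.≤-respˡ-≃ (ℚᵘₚ.≃-sym (toℚᵘ-divℕ a 0)) (ℚᵘₚ.≤-respʳ-≃ (ℚᵘₚ.≃-sym (toℚᵘ-divℕ b 0))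
  (ℚᵘ.*≤* (ℤₚ.*-monoʳ-≤-nonNeg (+ 1) (ℤ.+≤+ a≤b)))))

fromℕ-mono-< : ∀ {a b} → a ℕ.< b → fromℕ a < fromℕ b
fromℕ-mono-< {a} {b} a<b = ℚₚ.toℚᵘ-cancel-< (ℚᵘₚ.<-respˡ-≃ (ℚᵘₚ.≃-sym (toℚᵘ-divℕ a 0)) (ℚᵘₚ.<-respʳ-≃ (ℚᵘₚ.≃-sym (toℚᵘ-divℕ b 0))
  (ℚᵘ.*<* (ℤₚ.*-monoʳ-<-pos (+ 1) (ℤ.+<+ a<b)))))

fromℕ-*-divℕ : ∀ a b .{{_ : NonZero b}} → fromℕ b * divℕ a b ≡ fromℕ a
fromℕ-*-divℕ a (suc b) = ≡-via-toℚᵘ (ℚᵘ.mkℚᵘ (+ a) 0)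
  (ℚᵘₚ.≃-trans (ℚₚ.toℚᵘ-homo-* (fromℕ (suc b)) (divℕ a (suc b)))
    (ℚᵘₚ.≃-trans (ℚᵘₚ.*-cong (toℚᵘ-divℕ (suc b) 0) (toℚᵘ-divℕ a b))
      (ℚᵘ.*≡* (trans (ℤₚ.*-identityʳ _) (trans (ℤₚ.*-comm (+ suc b) (+ a))
        (cong (λ d → + a ℤ.* + d) (sym (ℕₚ.*-identityˡ (suc b)))))))))
  (toℚᵘ-divℕ a 0)

fromℕ-nonNeg : ∀ n → NonNegative (fromℕ n)
fromℕ-nonNeg n = ℚₚ.normalize-nonNeg n 1

fromℕ-pos : ∀ n .{{_ : NonZero n}} → Positive (fromℕ n)
fromℕ-pos (suc n) = ℚₚ.normalize-pos (suc n) 1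

∣fromℕ∣ : ∀ n → ∣ fromℕ n ∣ ≡ fromℕ n
∣fromℕ∣ n = ℚₚ.0≤p⇒∣p∣≡p (ℚₚ.nonNegative⁻¹ (fromℕ n) {{fromℕ-nonNeg n}})

*-cancelˡ-≡-pos : ∀ r .{{_ : Positive r}} {p s} → r * p ≡ r * s → p ≡ s
*-cancelˡ-≡-pos r eq =
  ℚₚ.≤-antisym (ℚₚ.*-cancelˡ-≤-pos r (ℚₚ.≤-reflexive eq)) (ℚₚ.*-cancelˡ-≤-pos r (ℚₚ.≤-reflexive (sym eq)))

fromℕ-*-divℕ-* : ∀ a b c .{{_ : NonZero b}} .{{_ : NonZero c}} →
                 fromℕ b * divℕ a (b ℕ.* c) ≡ divℕ a c
fromℕ-*-divℕ-* a b c = *-cancelˡ-≡-pos (fromℕ c) {{fromℕ-pos c}} (begin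
  fromℕ c * (fromℕ b * divℕ a (b ℕ.* c))  ≡⟨ solve 3 (λ x y z → x :* (y :* z) := (y :* x) :* z) refl (fromℕ c) (fromℕ b) _ ⟩
  fromℕ b * fromℕ c * divℕ a (b ℕ.* c)    ≡⟨ cong (_* divℕ a (b ℕ.* c)) (fromℕ-* b c) ⟨
  fromℕ (b ℕ.* c) * divℕ a (b ℕ.* c)      ≡⟨ fromℕ-*-divℕ a (b ℕ.* c) {{ℕₚ.m*n≢0 b c}} ⟩
  fromℕ a                                 ≡⟨ fromℕ-*-divℕ a c ⟨
  fromℕ c * divℕ a c                      ∎)
  where open ≡-Reasoning

mkℚ-*-fromℕ-denominator : ∀ n d .(c : Coprime n (suc d)) → mkℚ (+ n) d c * fromℕ (suc d) ≡ fromℕ n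
mkℚ-*-fromℕ-denominator n d c = ≡-via-toℚᵘ (ℚᵘ.mkℚᵘ (+ n) 0)
  (ℚᵘₚ.≃-trans (ℚₚ.toℚᵘ-homo-* (mkℚ (+ n) d c) (fromℕ (suc d)))
    (ℚᵘₚ.≃-trans (ℚᵘₚ.*-cong (ℚᵘₚ.≃-refl {ℚᵘ.mkℚᵘ (+ n) d}) (toℚᵘ-divℕ (suc d) 0))
      (ℚᵘ.*≡* (trans (ℤₚ.*-identityʳ _) (cong (λ k → + n ℤ.* + k) (sym (ℕₚ.*-identityʳ (suc d))))))))
  (toℚᵘ-divℕ n 0)

mkℚ+≤fromℕ-numerator : ∀ n d .(c : Coprime n (suc d)) → mkℚ (+ n) d c ≤ fromℕ n
mkℚ+≤fromℕ-numerator n d c = begin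
  r                  ≡⟨ ℚₚ.*-identityʳ r ⟨
  r * 1ℚ             ≤⟨ ℚₚ.*-monoˡ-≤-nonNeg r (fromℕ-mono-≤ {1} {suc d} (s≤s z≤n)) ⟩
  r * fromℕ (suc d)  ≡⟨ mkℚ-*-fromℕ-denominator n d c ⟩
  fromℕ n            ∎
  where
  open ℚₚ.≤-Reasoning
  r : ℚ
  r = mkℚ (+ n) d c

archimedean : ∀ r δ → Positive δ → ∃[ N ] r < δ * fromℕ N
archimedean (mkℚ -[1+ _ ] _ _) δ _ = 0 , ℚₚ.<-≤-trans (ℚ.*<* ℤ.-<+) (ℚₚ.≤-reflexive (sym (ℚₚ.*-zeroʳ δ)))
archimedean r@(mkℚ (+ a) d c) δ@(mkℚ +[1+ p ] d′ c′) _ = suc d′ ℕ.* suc a , (begin-strict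
  r                                      ≤⟨ mkℚ+≤fromℕ-numerator a d c ⟩
  fromℕ a                                <⟨ fromℕ-mono-< (ℕₚ.n<1+n a) ⟩
  fromℕ (suc a)                          ≤⟨ fromℕ-mono-≤ (ℕₚ.m≤n*m (suc a) (suc p)) ⟩
  fromℕ (suc p ℕ.* suc a)                ≡⟨ fromℕ-* (suc p) (suc a) ⟩
  fromℕ (suc p) * fromℕ (suc a)          ≡⟨ cong (_* fromℕ (suc a)) (mkℚ-*-fromℕ-denominator (suc p) d′ c′) ⟨
  δ * fromℕ (suc d′) * fromℕ (suc a)     ≡⟨ ℚₚ.*-assoc δ (fromℕ (suc d′)) (fromℕ (suc a)) ⟩
  δ * (fromℕ (suc d′) * fromℕ (suc a))   ≡⟨ cong (δ *_) (fromℕ-* (suc d′) (suc a)) ⟨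
  δ * fromℕ (suc d′ ℕ.* suc a)           ∎)
  where open ℚₚ.≤-Reasoning

p-q≡0⇒p≡q : ∀ {p q} → p - q ≡ 0ℚ → p ≡ q
p-q≡0⇒p≡q {p} {q} p-q≡0 = begin
  p            ≡⟨ solve 2 (λ x y → x := (x :- y) :+ y) refl p q ⟩
  p - q + q    ≡⟨ cong (_+ q) p-q≡0 ⟩
  0ℚ + q       ≡⟨ ℚₚ.+-identityˡ q ⟩
  q            ∎
  where open ≡-Reasoning

ConvergesTo-cong : ∀ {s t L} → s ≗ t → ConvergesTo s L → ConvergesTo t L
ConvergesTo-cong {L = L} s≗t s→L δ δ>0 with s→L δ δ>0
... | N , close = N , λ m N≤m → subst (λ x → ∣ x - L ∣ < δ) (s≗t m) (close m N≤m)

ConvergesTo-suc : ∀ {s L} → ConvergesTo s L → ConvergesTo (s ∘ suc) L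
ConvergesTo-suc s→L δ δ>0 with s→L δ δ>0
... | N , close = N , λ m N≤m → close (suc m) (ℕₚ.m≤n⇒m≤1+n N≤m)

ConvergesTo-const⇒≡ : ∀ {x L} → ConvergesTo (λ _ → x) L → x ≡ L
ConvergesTo-const⇒≡ {x} {L} x→L with ℚₚ.<-cmp 0ℚ ∣ x - L ∣
... | tri≈ _ 0≡∣x-L∣ _ = p-q≡0⇒p≡q (ℚₚ.∣p∣≡0⇒p≡0 (x - L) (sym 0≡∣x-L∣))
... | tri> _ _ ∣x-L∣<0 = ⊥-elim (ℚₚ.<-irrefl refl (ℚₚ.≤-<-trans (ℚₚ.0≤∣p∣ (x - L)) ∣x-L∣<0))
... | tri< 0<∣x-L∣ _ _ with x→L ∣ x - L ∣ (ℚ.positive 0<∣x-L∣)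
...   | N , close = ⊥-elim (ℚₚ.<-irrefl refl (close N ℕₚ.≤-refl))

ConvergesTo-*-- : ∀ a {s t L M} → ConvergesTo s L → ConvergesTo t M →
                  ConvergesTo (λ m → a * s m - t m) (a * L - M)
ConvergesTo-*-- a {s} {t} {L} {M} s→L t→M δ δ>0 = N₁ ℕ.+ N₂ , λ m N≤m → begin-strict
  ∣ a * s m - t m - (a * L - M) ∣
    ≡⟨ cong ∣_∣ (solve 5 (λ a x y l k → a :* x :- y :- (a :* l :- k) := a :* (x :- l) :- (y :- k)) refl a (s m) (t m) L M) ⟩
  ∣ a * (s m - L) - (t m - M) ∣            ≤⟨ ℚₚ.∣p-q∣≤∣p∣+∣q∣ (a * (s m - L)) (t m - M) ⟩
  ∣ a * (s m - L) ∣ + ∣ t m - M ∣          ≡⟨ cong (_+ ∣ t m - M ∣) (ℚₚ.∣p*q∣≡∣p∣*∣q∣ a (s m - L)) ⟩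
  ∣ a ∣ * ∣ s m - L ∣ + ∣ t m - M ∣        <⟨ ℚₚ.+-mono-≤-<
                                                 (ℚₚ.*-monoˡ-≤-nonNeg ∣ a ∣ {{ℚₚ.∣-∣-nonNeg a}} (ℚₚ.<⇒≤ (close₁ m (ℕₚ.m+n≤o⇒m≤o N₁ N≤m))))
                                                 (close₂ m (ℕₚ.m+n≤o⇒n≤o N₁ N≤m)) ⟩
  ∣ a ∣ * δ′ + δ′                          ≡⟨ solve 2 (λ x d → x :* d :+ d := (x :+ con 1ℚ) :* d) refl ∣ a ∣ δ′ ⟩
  r * δ′                                   ≡⟨ ℚₚ.*-assoc r (1/ r) δ ⟨
  r * 1/ r * δ                             ≡⟨ cong (_* δ) (ℚₚ.*-inverseʳ r) ⟩
  1ℚ * δ                                   ≡⟨ ℚₚ.*-identityˡ δ ⟩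
  δ                                        ∎
  where
  open ℚₚ.≤-Reasoning
  r : ℚ
  r = ∣ a ∣ + 1ℚ
  instance
    r>0 : Positive r
    r>0 = ℚₚ.nonNeg+pos⇒pos ∣ a ∣ {{ℚₚ.∣-∣-nonNeg a}} 1ℚ
    r≢0 : ℚ.NonZero r
    r≢0 = ℚₚ.pos⇒nonZero r
  δ′ : ℚ
  δ′ = 1/ r * δ
  δ′>0 : Positive δ′
  δ′>0 = ℚₚ.pos*pos⇒pos (1/ r) {{ℚₚ.1/pos⇒pos r}} δ {{δ>0}}
  N₁ N₂ : ℕ
  N₁ = proj₁ (s→L δ′ δ′>0)
  N₂ = proj₁ (t→M δ′ δ′>0)
  close₁ : ∀ m → N₁ ℕ.≤ m → ∣ s m - L ∣ < δ′
  close₁ = proj₂ (s→L δ′ δ′>0)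
  close₂ : ∀ m → N₂ ℕ.≤ m → ∣ t m - M ∣ < δ′
  close₂ = proj₂ (t→M δ′ δ′>0)

∣s-L∣*f≡r⇒ConvergesTo : ∀ {s L} (f : ℕ → ℕ) r → (∀ m → m ℕ.≤ f m) →
                         (∀ m → ∣ s m - L ∣ * fromℕ (f m) ≡ r) → ConvergesTo s L
∣s-L∣*f≡r⇒ConvergesTo {s} {L} f r m≤f error δ δ>0 with archimedean r δ δ>0
... | N , r<δN = N , λ m N≤m → ℚₚ.*-cancelʳ-<-nonNeg (fromℕ (f m)) {{fromℕ-nonNeg (f m)}} (begin-strict
  ∣ s m - L ∣ * fromℕ (f m)   ≡⟨ error m ⟩
  r                           <⟨ r<δN ⟩
  δ * fromℕ N                 ≤⟨ ℚₚ.*-monoˡ-≤-nonNeg δ {{ℚₚ.pos⇒nonNeg δ {{δ>0}}}} (fromℕ-mono-≤ (ℕₚ.≤-trans N≤m (m≤f m))) ⟩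
  δ * fromℕ (f m)             ∎)
  where open ℚₚ.≤-Reasoning

prod≢0 : ∀ {q} → (∀ i → NonZero (q i)) → ∀ n m → NonZero (prod q n m)
prod≢0 q≢0 n zero = _
prod≢0 {q} q≢0 n (suc m) = ℕₚ.m*n≢0 (q n) (prod q (suc n) m) {{q≢0 n}} {{prod≢0 q≢0 (suc n) m}}

m<prod : ∀ {q} → (∀ i → 1 ℕ.< q i) → ∀ n m → m ℕ.< prod q n m
m<prod 1<q n zero = s≤s z≤n
m<prod {q} 1<q n (suc m) = begin-strict
  suc m      ≤⟨ m<P ⟩
  P          ≡⟨ ℕₚ.*-identityˡ P ⟨
  1 ℕ.* P    <⟨ ℕₚ.*-monoˡ-< P {{ℕ.>-nonZero (ℕₚ.≤-<-trans z≤n m<P)}} (1<q n) ⟩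
  q n ℕ.* P  ∎
  where
  open ℕₚ.≤-Reasoning
  P : ℕ
  P = prod q (suc n) m
  m<P : m ℕ.< P
  m<P = m<prod 1<q (suc n) m

module _ (q e : ℕ → ℕ) (q≢0 : ∀ i → NonZero (q i)) where

  private
    T : ℕ → ℕ → ℚ
    T = tailPartial q e

  tailPartial-step : ∀ n m → fromℕ (q n) * T n (suc m) ≡ fromℕ (e n) + T (suc n) m
  tailPartial-step n zero = begin
    fromℕ (q n) * (0ℚ + divℕ (e (n ℕ.+ 0)) (q n ℕ.* 1))  ≡⟨ cong (fromℕ (q n) *_) (ℚₚ.+-identityˡ _) ⟩
    fromℕ (q n) * divℕ (e (n ℕ.+ 0)) (q n ℕ.* 1)         ≡⟨ fromℕ-*-divℕ-* (e (n ℕ.+ 0)) (q n) 1 {{q≢0 n}} ⟩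
    fromℕ (e (n ℕ.+ 0))                                  ≡⟨ cong (fromℕ ∘ e) (ℕₚ.+-identityʳ n) ⟩
    fromℕ (e n)                                          ≡⟨ ℚₚ.+-identityʳ (fromℕ (e n)) ⟨
    fromℕ (e n) + 0ℚ                                     ∎
    where open ≡-Reasoning
  tailPartial-step n (suc m) = begin
    fromℕ (q n) * (T n (suc m) + divℕ (e (n ℕ.+ suc m)) (q n ℕ.* P))
      ≡⟨ ℚₚ.*-distribˡ-+ (fromℕ (q n)) (T n (suc m)) _ ⟩
    fromℕ (q n) * T n (suc m) + fromℕ (q n) * divℕ (e (n ℕ.+ suc m)) (q n ℕ.* P)
      ≡⟨ cong₂ _+_ (tailPartial-step n m) (fromℕ-*-divℕ-* _ (q n) P {{q≢0 n}} {{prod≢0 q≢0 (suc n) (suc m)}}) ⟩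
    fromℕ (e n) + T (suc n) m + divℕ (e (n ℕ.+ suc m)) P
      ≡⟨ ℚₚ.+-assoc (fromℕ (e n)) (T (suc n) m) _ ⟩
    fromℕ (e n) + (T (suc n) m + divℕ (e (n ℕ.+ suc m)) P)
      ≡⟨ cong (λ k → fromℕ (e n) + (T (suc n) m + divℕ (e k) P)) (ℕₚ.+-suc n m) ⟩
    fromℕ (e n) + T (suc n) (suc m)
      ∎
    where
    open ≡-Reasoning
    P : ℕ
    P = prod q (suc n) (suc m)

  ConvergesTo-tailPartial⇒e+c≡q*c : ∀ {c} n → ConvergesTo (T n) c → ConvergesTo (T (suc n)) c →
                                     fromℕ (e n) + c ≡ fromℕ (q n) * c
  ConvergesTo-tailPartial⇒e+c≡q*c {c} n Tₙ→c Tₙ₊₁→c = begin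
    fromℕ (e n) + c              ≡⟨ cong (_+ c) e≡q*c-c ⟩
    fromℕ (q n) * c - c + c      ≡⟨ solve 2 (λ x y → x :- y :+ y := x) refl (fromℕ (q n) * c) c ⟩
    fromℕ (q n) * c              ∎
    where
    open ≡-Reasoning
    step : ∀ m → fromℕ (q n) * T n (suc m) - T (suc n) m ≡ fromℕ (e n)
    step m = begin
      fromℕ (q n) * T n (suc m) - T (suc n) m      ≡⟨ cong (_- T (suc n) m) (tailPartial-step n m) ⟩
      fromℕ (e n) + T (suc n) m - T (suc n) m      ≡⟨ solve 2 (λ x y → x :+ y :- y := x) refl (fromℕ (e n)) (T (suc n) m) ⟩
      fromℕ (e n)                                  ∎
    e≡q*c-c : fromℕ (e n) ≡ fromℕ (q n) * c - c
    e≡q*c-c = ConvergesTo-const⇒≡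
      (ConvergesTo-cong step (ConvergesTo-*-- (fromℕ (q n)) (ConvergesTo-suc {T n} Tₙ→c) Tₙ₊₁→c))

  e+c≡q*c⇒prod*[tailPartial-c]≡-c : ∀ {c} → (∀ i → fromℕ (e i) + c ≡ fromℕ (q i) * c) →
                                     ∀ n m → fromℕ (prod q n m) * (T n m - c) ≡ - c
  e+c≡q*c⇒prod*[tailPartial-c]≡-c {c} _ n zero = solve 1 (λ x → con 1ℚ :* (con 0ℚ :- x) := :- x) refl c
  e+c≡q*c⇒prod*[tailPartial-c]≡-c {c} e+c≡q*c n (suc m) = begin
    fromℕ (q n ℕ.* P) * (T n (suc m) - c)
      ≡⟨ cong (_* (T n (suc m) - c)) (fromℕ-* (q n) P) ⟩
    fromℕ (q n) * fromℕ P * (T n (suc m) - c)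
      ≡⟨ solve 4 (λ x y t z → x :* y :* (t :- z) := y :* (x :* t :- x :* z)) refl (fromℕ (q n)) (fromℕ P) (T n (suc m)) c ⟩
    fromℕ P * (fromℕ (q n) * T n (suc m) - fromℕ (q n) * c)
      ≡⟨ cong₂ (λ x y → fromℕ P * (x - y)) (tailPartial-step n m) (sym (e+c≡q*c n)) ⟩
    fromℕ P * (fromℕ (e n) + T (suc n) m - (fromℕ (e n) + c))
      ≡⟨ cong (fromℕ P *_) (solve 3 (λ x t z → x :+ t :- (x :+ z) := t :- z) refl (fromℕ (e n)) (T (suc n) m) c) ⟩
    fromℕ P * (T (suc n) m - c)
      ≡⟨ e+c≡q*c⇒prod*[tailPartial-c]≡-c e+c≡q*c (suc n) m ⟩
    - c
      ∎
    where
    open ≡-Reasoning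
    P : ℕ
    P = prod q (suc n) m

e+c≡q*c⇒ConvergesTo-tailPartial : ∀ q e {c} → (∀ i → 1 ℕ.< q i) →
                                   (∀ i → fromℕ (e i) + c ≡ fromℕ (q i) * c) →
                                   ∀ n → ConvergesTo (tailPartial q e n) c
e+c≡q*c⇒ConvergesTo-tailPartial q e {c} 1<q e+c≡q*c n =
  ∣s-L∣*f≡r⇒ConvergesTo {tailPartial q e n} (prod q n) ∣ c ∣ (λ m → ℕₚ.<⇒≤ (m<prod 1<q n m)) error
  where
  q≢0 : ∀ i → NonZero (q i)
  q≢0 i = ℕ.>-nonZero (ℕₚ.<⇒≤ (1<q i))
  error : ∀ m → ∣ tailPartial q e n m - c ∣ * fromℕ (prod q n m) ≡ ∣ c ∣
  error m = begin
    ∣ x ∣ * fromℕ P      ≡⟨ cong (∣ x ∣ *_) (∣fromℕ∣ P) ⟨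
    ∣ x ∣ * ∣ fromℕ P ∣  ≡⟨ ℚₚ.∣p*q∣≡∣p∣*∣q∣ x (fromℕ P) ⟨
    ∣ x * fromℕ P ∣      ≡⟨ cong ∣_∣ (ℚₚ.*-comm x (fromℕ P)) ⟩
    ∣ fromℕ P * x ∣      ≡⟨ cong ∣_∣ (e+c≡q*c⇒prod*[tailPartial-c]≡-c q e q≢0 e+c≡q*c n m) ⟩
    ∣ - c ∣              ≡⟨ ℚₚ.∣-p∣≡∣p∣ c ⟩
    ∣ c ∣                ∎
    where
    open ≡-Reasoning
    x : ℚ
    x = tailPartial q e n m - c
    P : ℕ
    P = prod q n m

a+c/k≡b*c/k⇔a*k≡[b∸1]*c : ∀ a b c k .{{_ : NonZero b}} .{{_ : NonZero k}} →
                           (fromℕ a + divℕ c k ≡ fromℕ b * divℕ c k) ⇔ (a ℕ.* k ≡ (b ℕ.∸ 1) ℕ.* c)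
a+c/k≡b*c/k⇔a*k≡[b∸1]*c a b@(suc b-1) c k = mk⇔
  (λ eq → ℕₚ.+-cancelʳ-≡ c (a ℕ.* k) (b-1 ℕ.* c)
            (trans (fromℕ-injective (trans (sym lhs) (trans (cong (fromℕ k *_) eq) rhs))) (ℕₚ.+-comm c (b-1 ℕ.* c))))
  (λ eq → *-cancelˡ-≡-pos (fromℕ k) {{fromℕ-pos k}}
            (trans lhs (trans (cong fromℕ (trans (cong (ℕ._+ c) eq) (ℕₚ.+-comm (b-1 ℕ.* c) c))) (sym rhs))))
  where
  open ≡-Reasoning
  lhs : fromℕ k * (fromℕ a + divℕ c k) ≡ fromℕ (a ℕ.* k ℕ.+ c)
  lhs = begin
    fromℕ k * (fromℕ a + divℕ c k)           ≡⟨ ℚₚ.*-distribˡ-+ (fromℕ k) (fromℕ a) (divℕ c k) ⟩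
    fromℕ k * fromℕ a + fromℕ k * divℕ c k   ≡⟨ cong₂ _+_ (ℚₚ.*-comm (fromℕ k) (fromℕ a)) (fromℕ-*-divℕ c k) ⟩
    fromℕ a * fromℕ k + fromℕ c              ≡⟨ cong (_+ fromℕ c) (fromℕ-* a k) ⟨
    fromℕ (a ℕ.* k) + fromℕ c                ≡⟨ fromℕ-+ (a ℕ.* k) c ⟨
    fromℕ (a ℕ.* k ℕ.+ c)                    ∎
  rhs : fromℕ k * (fromℕ b * divℕ c k) ≡ fromℕ (b ℕ.* c)
  rhs = begin
    fromℕ k * (fromℕ b * divℕ c k)   ≡⟨ solve 3 (λ x y z → x :* (y :* z) := y :* (x :* z)) refl (fromℕ k) (fromℕ b) (divℕ c k) ⟩
    fromℕ b * (fromℕ k * divℕ c k)   ≡⟨ cong (fromℕ b *_) (fromℕ-*-divℕ c k) ⟩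
    fromℕ b * fromℕ c                ≡⟨ fromℕ-* b c ⟨
    fromℕ (b ℕ.* c)                  ∎

lemma4 : (q : ℕ → ℕ) → (∀ i → 1 ℕ.< q i) →
         (qmin : ℕ) → (∀ i → qmin ℕ.≤ q i) → (∃[ i ] q i ≡ qmin) →
         (ε : ℕ) → ε ℕ.< qmin →
         (e : ℕ → ℕ) → (∀ i → e i ℕ.< q i) →
         ((∀ n → ConvergesTo (tailPartial q e n) (divℕ ε (qmin ℕ.∸ 1)))
           ⇔ (∀ n → e n ℕ.* (qmin ℕ.∸ 1) ≡ (q n ℕ.∸ 1) ℕ.* ε))
lemma4 q 1<q qmin _ (i , qᵢ≡qmin) ε _ e _ = mk⇔
  (λ T→c n → Equivalence.to (digit⇔ n)
               (ConvergesTo-tailPartial⇒e+c≡q*c q e q≢0 n (T→c n) (T→c (suc n))))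
  (λ digits → e+c≡q*c⇒ConvergesTo-tailPartial q e 1<q (λ n → Equivalence.from (digit⇔ n) (digits n)))
  where
  q≢0 : ∀ n → NonZero (q n)
  q≢0 n = ℕ.>-nonZero (ℕₚ.<⇒≤ (1<q n))
  instance
    qmin∸1≢0 : NonZero (qmin ℕ.∸ 1)
    qmin∸1≢0 = ℕ.>-nonZero (ℕₚ.∸-monoˡ-≤ 1 (subst (2 ℕ.≤_) qᵢ≡qmin (1<q i)))
  digit⇔ : ∀ n → (fromℕ (e n) + divℕ ε (qmin ℕ.∸ 1) ≡ fromℕ (q n) * divℕ ε (qmin ℕ.∸ 1))
                 ⇔ (e n ℕ.* (qmin ℕ.∸ 1) ≡ (q n ℕ.∸ 1) ℕ.* ε)
  digit⇔ n = a+c/k≡b*c/k⇔a*k≡[b∸1]*c (e n) (q n) ε (qmin ℕ.∸ 1) {{q≢0 n}}
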